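{- Let $F$ be a non-archimedean local field of characteristic $0$ with ring of integers $\mathcal{O}$ and uniformiser $\varpi$, and let $G=\mathrm{GL}_2(F)$. Let $A\le G$ be the diagonal subgroup, $N\le G$ the upper triangular unipotent subgroup, and $K_A=A\cap\mathrm{GL}_2(\mathcal{O})$. Consider the two-sided action of $A\times K_A$ on $N\backslash G$: $A$ acts by left multiplication, which is well defined because $A$ normalises $N$, and $K_A$ acts by right multiplication. Then the cosets $N\kappa$ with $$\kappa=\begin{pmatrix}1&0\\ \varpi^{\gamma}&1\end{pmatrix}\ (0\le\gamma\le\infty)\qquad\text{and}\qquad \kappa=\begin{pmatrix}0&1\\ 1&\varpi^{\gamma}\end{pmatrix}\ (1\le\gamma\le\infty)$$ form a set of representatives for the orbits of this action. That is, each orbit contains exactly one of these cosets.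
   Context: The convention $\varpi^\infty=0$ is used. -}

module Defs where

open import Level using (Level; _⊔_) renaming (suc to lsuc)
open import Algebra.Bundles using (CommutativeRing)
open import Data.Nat as ℕ using (ℕ; zero; suc)
open import Data.Integer as ℤ using (ℤ; +_)
open import Data.List using (List)
open import Data.List.Relation.Unary.All using (All)
open import Data.List.Relation.Unary.Any using (Any)
open import Data.Product using (Σ; _×_; ∃)
open import Data.Unit.Polymorphic using (⊤)
open import Data.Empty.Polymorphic using (⊥)
open import Relation.Nullary using (¬_)
open import Relation.Binary.PropositionalEquality using (_≡_)

-- ℤ ∪ {∞}: value group of a discrete valuation (v 0 = ∞)
data ℤ∞ : Set where
  fin : ℤ → ℤ∞
  ∞   : ℤ∞

_+∞_ : ℤ∞ → ℤ∞ → ℤ∞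
fin a +∞ fin b = fin (a ℤ.+ b)
_     +∞ _     = ∞

min∞ : ℤ∞ → ℤ∞ → ℤ∞
min∞ (fin a) (fin b) = fin (a ℤ.⊓ b)
min∞ (fin a) ∞ = fin a
min∞ ∞ y = y

data _≤∞_ : ℤ∞ → ℤ∞ → Set where
  fin≤fin : ∀ {a b} → a ℤ.≤ b → fin a ≤∞ fin b
  ≤∞∞     : ∀ {x} → x ≤∞ ∞

-- ℕ ∪ {∞}: exponents γ, with the convention ϖ^∞ = 0
data ℕ∞ : Set where
  fin : ℕ → ℕ∞
  ∞   : ℕ∞

ι : ∀ {c ℓ} (R : CommutativeRing c ℓ) → ℕ → CommutativeRing.Carrier R
ι R zero = CommutativeRing.0# R
ι R (suc n) = CommutativeRing._+_ R (CommutativeRing.1# R) (ι R n)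

record NALocalField (c ℓ : Level) : Set (lsuc (c ⊔ ℓ)) where
  field
    cring : CommutativeRing c ℓ
  open CommutativeRing cring public
  field
    nontrivial : ¬ (1# ≈ 0#)
    inv        : (x : Carrier) → ¬ (x ≈ 0#) → Carrier
    inv-r      : ∀ x (p : ¬ (x ≈ 0#)) → x * inv x p ≈ 1#
    char0      : ∀ n → ¬ (ι cring (suc n) ≈ 0#)
    v          : Carrier → ℤ∞
    v-cong     : ∀ {x y} → x ≈ y → v x ≡ v y
    v-∞⇒0      : ∀ x → v x ≡ ∞ → x ≈ 0#
    v-0        : v 0# ≡ ∞
    v-*        : ∀ x y → v (x * y) ≡ v x +∞ v y
    v-+        : ∀ x y → min∞ (v x) (v y) ≤∞ v (x + y)
    ϖ          : Carrier
    v-ϖ        : v ϖ ≡ fin (+ 1)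
    -- finite residue field: finitely many elements of O represent O/ϖO
    residues       : List Carrier
    residues-int   : All (λ r → fin (+ 0) ≤∞ v r) residues
    residues-cover : ∀ x → fin (+ 0) ≤∞ v x →
                     Any (λ r → fin (+ 1) ≤∞ v (x - r)) residues
    complete :
      (a : ℕ → Carrier) →
      (∀ (k : ℕ) → ∃ λ M → ∀ m n → M ℕ.≤ m → M ℕ.≤ n → fin (+ k) ≤∞ v (a m - a n)) →
      Σ Carrier λ l → ∀ (k : ℕ) → ∃ λ M → ∀ m → M ℕ.≤ m → fin (+ k) ≤∞ v (a m - l)

module GL2 {c ℓ : Level} (F : NALocalField c ℓ) where
  open NALocalField F

  inO : Carrier → Set
  inO x = fin (+ 0) ≤∞ v x

  record M2 : Set c where
    constructor mat
    field
      e11 e12 e21 e22 : Carrier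
  open M2 public

  _·_ : M2 → M2 → M2
  mat a b c' d · mat a' b' c'' d' =
    mat (a * a' + b * c'') (a * b' + b * d') (c' * a' + d * c'') (c' * b' + d * d')
  infixl 7 _·_

  _≈M_ : M2 → M2 → Set ℓ
  m ≈M n = (e11 m ≈ e11 n) × (e12 m ≈ e12 n) × (e21 m ≈ e21 n) × (e22 m ≈ e22 n)

  det : M2 → Carrier
  det m = e11 m * e22 m - e12 m * e21 m

  inG : M2 → Set ℓ
  inG m = ¬ (det m ≈ 0#)

  inGLO : M2 → Set
  inGLO m = inO (e11 m) × inO (e12 m) × inO (e21 m) × inO (e22 m) × (v (det m) ≡ fin (+ 0))

  inA : M2 → Set ℓ
  inA m = inG m × (e12 m ≈ 0#) × (e21 m ≈ 0#)

  inN : M2 → Set ℓ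
  inN m = (e11 m ≈ 1#) × (e21 m ≈ 0#) × (e22 m ≈ 1#)

  inKA : M2 → Set ℓ
  inKA m = inA m × inGLO m

  -- The orbit of N g under A × K_A (a·Ng·k = N a g k) contains N h
  SameOrbit : M2 → M2 → Set (c ⊔ ℓ)
  SameOrbit g h = Σ M2 λ a → Σ M2 λ k → Σ M2 λ n →
    inA a × inKA k × inN n × (h ≈M (n · (a · g · k)))

  ϖ^ : ℕ∞ → Carrier
  ϖ^ ∞ = 0#
  ϖ^ (fin zero) = 1#
  ϖ^ (fin (suc n)) = ϖ * ϖ^ (fin n)

  data 1≤∞ : ℕ∞ → Set where
    1≤fin : ∀ {n} → 1≤∞ (fin (suc n))
    1≤∞∞  : 1≤∞ ∞

  data Rep : Set where
    lower : (γ : ℕ∞) → Rep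
    swap  : (γ : ℕ∞) → 1≤∞ γ → Rep

  κ : Rep → M2
  κ (lower γ)  = mat 1# 0# (ϖ^ γ) 1#
  κ (swap γ _) = mat 0# 1# 1# (ϖ^ γ)

{-# OPTIONS --safe #-}
module Submission where

-- Since N adds multiples of the bottom row to the top row and the first diagonal entry of an
-- element of A rescales the determinant, two matrices of G lie in the same orbit exactly when
-- their bottom rows satisfy (c′, d′) = (a c k₁, a d k₂) with a ∈ F× and k₁, k₂ ∈ O×; the
-- remaining parameters are found by Cramer's rule. Dividing by the entry of smaller valuation
-- and absorbing units into k₁, k₂ brings every bottom row to (ϖ^γ, 1), or to (1, ϖ^γ) with γ ≥ 1.
-- Conversely, the bottom-row valuations of each representative have minimum 0, so the scalar a
-- relating two representatives is a unit, and the valuations (γ, 0) or (0, γ) then determine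
-- the representative.

open import Algebra.Bundles using (CommutativeRing)
open import Data.Empty using (⊥-elim)
open import Data.Product using (Σ; Σ-syntax; _×_; _,_; proj₁; proj₂)
open import Data.Integer as ℤ using (ℤ; +_; -[1+_]; _⊖_)
open import Data.Integer.Tactic.RingSolver using (solve-∀)
open import Data.Nat as ℕ using (ℕ; zero; suc)
open import Data.Sum using (_⊎_; inj₁; inj₂)
open import Function using (_∘_)
open import Level using (Level; _⊔_)
open import Relation.Binary.Consequences using (dec⇒weaklyDec)
open import Relation.Binary.PropositionalEquality as ≡ using (_≡_; _≢_)
import Algebra.Properties.AbelianGroup
import Algebra.Solver.Ring
import Algebra.Solver.Ring.AlmostCommutativeRing as ACR
import Data.Integer.Properties as ℤ
import Data.Maybe as Maybe
import Data.Nat.Properties as ℕ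
import Relation.Binary.Reasoning.Setoid

open import Defs

-- The ring solver compares normal forms syntactically, so its coefficients must have decidable
-- equality: we use ℤ, which maps into every commutative ring. The optimised _×′_ makes
-- fromℤ (+ 1) reduce to 1#, so that the constant con (+ 1) matches 1# in goals.
module IntegerCoefficientSolver {c ℓ} (R : CommutativeRing c ℓ) where
  open CommutativeRing R
  open import Algebra.Properties.Ring ring
    using (-0#≈0#; -‿involutive; -‿+-comm; -‿distribˡ-*; -‿distribʳ-*)
  open import Algebra.Properties.Semiring.Mult.TCOptimised semiring using (1+×; ×-homo-+; ×1-homo-*)
    renaming (_×_ to _×′_)
  open import Algebra.Properties.CommutativeSemigroup +-commutativeSemigroup using (interchange)
  open import Relation.Binary.Reasoning.Setoid setoid

  fromℤ : ℤ → Carrier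
  fromℤ (+ n)    = n ×′ 1#
  fromℤ -[1+ n ] = - (suc n ×′ 1#)

  fromℤ-homo-neg : ∀ i → fromℤ (ℤ.- i) ≈ - fromℤ i
  fromℤ-homo-neg (+ zero)  = sym -0#≈0#
  fromℤ-homo-neg (+ suc n) = refl
  fromℤ-homo-neg -[1+ n ]  = sym (-‿involutive _)

  [1+x]-[1+y]≈x-y : ∀ x y → (1# + x) - (1# + y) ≈ x - y
  [1+x]-[1+y]≈x-y x y = begin
    (1# + x) - (1# + y)    ≈⟨ +-congˡ (-‿+-comm 1# y) ⟨
    (1# + x) + (- 1# - y)  ≈⟨ interchange 1# x (- 1#) (- y) ⟩
    (1# - 1#) + (x - y)    ≈⟨ +-congʳ (-‿inverseʳ 1#) ⟩
    0# + (x - y)           ≈⟨ +-identityˡ (x - y) ⟩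
    x - y                  ∎

  fromℤ-homo-⊖ : ∀ m n → fromℤ (m ⊖ n) ≈ m ×′ 1# - n ×′ 1#
  fromℤ-homo-⊖ m       zero    = sym (trans (+-congˡ -0#≈0#) (+-identityʳ _))
  fromℤ-homo-⊖ zero    (suc n) = sym (+-identityˡ _)
  fromℤ-homo-⊖ (suc m) (suc n) rewrite ℤ.[1+m]⊖[1+n]≡m⊖n m n = begin
    fromℤ (m ⊖ n)                    ≈⟨ fromℤ-homo-⊖ m n ⟩
    m ×′ 1# - n ×′ 1#                ≈⟨ [1+x]-[1+y]≈x-y (m ×′ 1#) (n ×′ 1#) ⟨
    (1# + m ×′ 1#) - (1# + n ×′ 1#)  ≈⟨ +-cong (1+× m 1#) (-‿cong (1+× n 1#)) ⟨
    suc m ×′ 1# - suc n ×′ 1#        ∎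

  fromℤ-homo-+ : ∀ i j → fromℤ (i ℤ.+ j) ≈ fromℤ i + fromℤ j
  fromℤ-homo-+ (+ m)    (+ n)    = ×-homo-+ 1# m n
  fromℤ-homo-+ (+ m)    -[1+ n ] = fromℤ-homo-⊖ m (suc n)
  fromℤ-homo-+ -[1+ m ] (+ n)    = trans (fromℤ-homo-⊖ n (suc m)) (+-comm _ _)
  fromℤ-homo-+ -[1+ m ] -[1+ n ] = begin
    - (suc (suc m ℕ.+ n) ×′ 1#)        ≡⟨ ≡.cong (λ k → - (suc k ×′ 1#)) (ℕ.+-suc m n) ⟨
    - ((suc m ℕ.+ suc n) ×′ 1#)        ≈⟨ -‿cong (×-homo-+ 1# (suc m) (suc n)) ⟩
    - (suc m ×′ 1# + suc n ×′ 1#)      ≈⟨ -‿+-comm _ _ ⟨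
    - (suc m ×′ 1#) + - (suc n ×′ 1#)  ∎

  fromℤ-homo-* : ∀ i j → fromℤ (i ℤ.* j) ≈ fromℤ i * fromℤ j
  fromℤ-homo-* (+ m) (+ n) rewrite ℤ.+◃n≡+n (m ℕ.* n) = ×1-homo-* m n
  fromℤ-homo-* (+ m) -[1+ n ] rewrite ℤ.-◃n≡-n (m ℕ.* suc n) = begin
    fromℤ (ℤ.- + (m ℕ.* suc n))  ≈⟨ fromℤ-homo-neg (+ (m ℕ.* suc n)) ⟩
    - ((m ℕ.* suc n) ×′ 1#)      ≈⟨ -‿cong (×1-homo-* m (suc n)) ⟩
    - (m ×′ 1# * suc n ×′ 1#)    ≈⟨ -‿distribʳ-* _ _ ⟩
    m ×′ 1# * - (suc n ×′ 1#)    ∎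
  fromℤ-homo-* -[1+ m ] (+ n) rewrite ℤ.-◃n≡-n (suc m ℕ.* n) = begin
    fromℤ (ℤ.- + (suc m ℕ.* n))  ≈⟨ fromℤ-homo-neg (+ (suc m ℕ.* n)) ⟩
    - ((suc m ℕ.* n) ×′ 1#)      ≈⟨ -‿cong (×1-homo-* (suc m) n) ⟩
    - (suc m ×′ 1# * n ×′ 1#)    ≈⟨ -‿distribˡ-* _ _ ⟩
    - (suc m ×′ 1#) * n ×′ 1#    ∎
  fromℤ-homo-* -[1+ m ] -[1+ n ] = begin
    (suc m ℕ.* suc n) ×′ 1#            ≈⟨ ×1-homo-* (suc m) (suc n) ⟩
    suc m ×′ 1# * suc n ×′ 1#          ≈⟨ -‿involutive _ ⟨
    - - (suc m ×′ 1# * suc n ×′ 1#)    ≈⟨ -‿cong (-‿distribˡ-* _ _) ⟩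
    - (- (suc m ×′ 1#) * suc n ×′ 1#)  ≈⟨ -‿distribʳ-* _ _ ⟩
    - (suc m ×′ 1#) * - (suc n ×′ 1#)  ∎

  fromℤ-morphism : ℤ.+-*-rawRing ACR.-Raw-AlmostCommutative⟶ ACR.fromCommutativeRing R
  fromℤ-morphism = record
    { ⟦_⟧    = fromℤ
    ; +-homo = fromℤ-homo-+
    ; *-homo = fromℤ-homo-*
    ; -‿homo = fromℤ-homo-neg
    ; 0-homo = refl
    ; 1-homo = refl
    }

  open Algebra.Solver.Ring ℤ.+-*-rawRing (ACR.fromCommutativeRing R) fromℤ-morphism
    (λ i j → Maybe.map (reflexive ∘ ≡.cong fromℤ) (dec⇒weaklyDec ℤ._≟_ i j)) public

toℤ∞ : ℕ∞ → ℤ∞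
toℤ∞ (fin n) = fin (+ n)
toℤ∞ ∞       = ∞

fin-injective : ∀ {a b : ℤ} → ℤ∞.fin a ≡ fin b → a ≡ b
fin-injective ≡.refl = ≡.refl

toℤ∞-injective : ∀ {γ δ} → toℤ∞ γ ≡ toℤ∞ δ → γ ≡ δ
toℤ∞-injective {fin m} {fin n} eq = ≡.cong ℕ∞.fin (ℤ.+-injective (fin-injective eq))
toℤ∞-injective {∞}     {∞}     eq = ≡.refl

+∞-identityˡ : ∀ X → fin (+ 0) +∞ X ≡ X
+∞-identityˡ (fin a) = ≡.cong ℤ∞.fin (ℤ.+-identityˡ a)
+∞-identityˡ ∞       = ≡.refl

+∞-identityʳ : ∀ X → X +∞ fin (+ 0) ≡ X
+∞-identityʳ (fin a) = ≡.cong ℤ∞.fin (ℤ.+-identityʳ a)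
+∞-identityʳ ∞       = ≡.refl

+∞-identityˡ-unique : ∀ X t → X +∞ fin t ≡ fin t → X ≡ fin (+ 0)
+∞-identityˡ-unique (fin a) t eq = ≡.cong ℤ∞.fin (identityˡ-unique a t (fin-injective eq))
  where open Algebra.Properties.AbelianGroup ℤ.+-0-abelianGroup using (identityˡ-unique)

nonNegative-+∞≡0 : ∀ {X Y} → fin (+ 0) ≤∞ X → fin (+ 0) ≤∞ Y → X +∞ Y ≡ fin (+ 0) →
                   X ≡ fin (+ 0) × Y ≡ fin (+ 0)
nonNegative-+∞≡0 (fin≤fin (ℤ.+≤+ {n = m} _)) (fin≤fin (ℤ.+≤+ {n = n} _)) eq =
  ≡.cong (ℤ∞.fin ∘ +_) (ℕ.m+n≡0⇒m≡0 m m+n≡0) , ≡.cong (ℤ∞.fin ∘ +_) (ℕ.m+n≡0⇒n≡0 m m+n≡0)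
  where m+n≡0 = ℤ.+-injective (fin-injective eq)
nonNegative-+∞≡0 (fin≤fin _) ≤∞∞ ()
nonNegative-+∞≡0 ≤∞∞         _   ()

min∞-+∞ : ∀ t X Y → min∞ (fin t +∞ X) (fin t +∞ Y) ≡ fin t +∞ min∞ X Y
min∞-+∞ t (fin a) (fin b) = ≡.cong ℤ∞.fin (≡.sym (ℤ.mono-≤-distrib-⊓ (ℤ.+-monoʳ-≤ t) a b))
min∞-+∞ t (fin a) ∞       = ≡.refl
min∞-+∞ t ∞       Y       = ≡.refl

min∞-0-toℤ∞ : ∀ γ → min∞ (fin (+ 0)) (toℤ∞ γ) ≡ fin (+ 0)
min∞-0-toℤ∞ (fin n) = ≡.refl
min∞-0-toℤ∞ ∞       = ≡.refl

min∞-toℤ∞-0 : ∀ γ → min∞ (toℤ∞ γ) (fin (+ 0)) ≡ fin (+ 0)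
min∞-toℤ∞-0 (fin n) = ≡.cong (ℤ∞.fin ∘ +_) (ℕ.⊓-zeroʳ n)
min∞-toℤ∞-0 ∞       = ≡.refl

min≡0-shift⇒≡ : ∀ {t X Y X′ Y′} → min∞ X Y ≡ fin (+ 0) → min∞ X′ Y′ ≡ fin (+ 0) →
                X′ ≡ fin t +∞ X → Y′ ≡ fin t +∞ Y → X′ ≡ X × Y′ ≡ Y
min≡0-shift⇒≡ {t} {X} {Y} min≡0 min′≡0 ≡.refl ≡.refl with t≡0
  where
  open ≡.≡-Reasoning
  t+0≡0 : fin t +∞ fin (+ 0) ≡ fin (+ 0)
  t+0≡0 = begin
    fin t +∞ fin (+ 0)              ≡⟨ ≡.cong (fin t +∞_) min≡0 ⟨
    fin t +∞ min∞ X Y               ≡⟨ min∞-+∞ t X Y ⟨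
    min∞ (fin t +∞ X) (fin t +∞ Y)  ≡⟨ min′≡0 ⟩
    fin (+ 0)                       ∎
  t≡0 : t ≡ + 0
  t≡0 = ≡.trans (≡.sym (ℤ.+-identityʳ t)) (fin-injective t+0≡0)
... | ≡.refl = +∞-identityˡ X , +∞-identityˡ Y

compare-with-fin : ∀ X j → (Σ[ γ ∈ ℕ∞ ] X ≡ toℤ∞ γ +∞ fin j)
                         ⊎ (Σ[ i ∈ ℤ ] Σ[ m ∈ ℕ ] X ≡ fin i × fin j ≡ fin (+ suc m) +∞ fin i)
compare-with-fin ∞       j = inj₁ (∞ , ≡.refl)
compare-with-fin (fin i) j with i ℤ.- j in i-j≡
... | + n      = inj₁ (ℕ∞.fin n , ≡.cong ℤ∞.fin (≡.trans (i≡[i-j]+j i j) (≡.cong (ℤ._+ j) i-j≡)))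
  where
  i≡[i-j]+j : ∀ i j → i ≡ (i ℤ.- j) ℤ.+ j
  i≡[i-j]+j = solve-∀
... | -[1+ m ] =
  inj₂ (i , m , ≡.refl , ≡.cong ℤ∞.fin (≡.trans (j≡-[i-j]+i i j) (≡.cong (λ d → ℤ.- d ℤ.+ i) i-j≡)))
  where
  j≡-[i-j]+i : ∀ i j → j ≡ ℤ.- (i ℤ.- j) ℤ.+ i
  j≡-[i-j]+i = solve-∀

module Orbits {c ℓ : Level} (F : NALocalField c ℓ) where
  open NALocalField F
  open GL2 F
  open IntegerCoefficientSolver cring using (solve; _:=_; _:+_; _:*_; _:-_; :-_; con)
  open import Algebra.Properties.Ring ring using (-0#≈0#)
  module ≈-Reasoning = Relation.Binary.Reasoning.Setoid setoid

  v-fin⇒≉0 : ∀ {x t} → v x ≡ fin t → x ≉ 0#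
  v-fin⇒≉0 {x} vx x≈0 with ≡.trans (≡.sym vx) (≡.trans (v-cong x≈0) v-0)
  ... | ()

  ≉0⇒v-fin : ∀ {x} → x ≉ 0# → Σ[ t ∈ ℤ ] v x ≡ fin t
  ≉0⇒v-fin {x} x≉0 with v x in vx
  ... | fin t = t , ≡.refl
  ... | ∞     = ⊥-elim (x≉0 (v-∞⇒0 x vx))

  *-≉0 : ∀ {x y} → x ≉ 0# → y ≉ 0# → x * y ≉ 0#
  *-≉0 {x} {y} x≉0 y≉0 with ≉0⇒v-fin x≉0 | ≉0⇒v-fin y≉0
  ... | s , vx | t , vy = v-fin⇒≉0 (≡.trans (v-* x y) (≡.cong₂ _+∞_ vx vy))

  inv-≉0 : ∀ {x} (x≉0 : x ≉ 0#) → inv x x≉0 ≉ 0#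
  inv-≉0 {x} x≉0 x⁻¹≈0 = nontrivial (begin
    1#             ≈⟨ inv-r x x≉0 ⟨
    x * inv x x≉0  ≈⟨ *-congˡ x⁻¹≈0 ⟩
    x * 0#         ≈⟨ zeroʳ x ⟩
    0#             ∎)
    where open ≈-Reasoning

  inv-l : ∀ {x} (x≉0 : x ≉ 0#) → inv x x≉0 * x ≈ 1#
  inv-l {x} x≉0 = trans (*-comm _ x) (inv-r x x≉0)

  v-1 : v 1# ≡ fin (+ 0)
  v-1 with ≉0⇒v-fin nontrivial
  ... | t , v1≡t = ≡.trans v1≡t (+∞-identityˡ-unique (fin t) t (begin
    fin t +∞ fin t  ≡⟨ ≡.cong₂ _+∞_ v1≡t v1≡t ⟨
    v 1# +∞ v 1#    ≡⟨ v-* 1# 1# ⟨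
    v (1# * 1#)     ≡⟨ v-cong (*-identityˡ 1#) ⟩
    v 1#            ≡⟨ v1≡t ⟩
    fin t           ∎))
    where open ≡.≡-Reasoning

  v-ϖ^ : ∀ γ → v (ϖ^ γ) ≡ toℤ∞ γ
  v-ϖ^ ∞             = v-0
  v-ϖ^ (fin zero)    = v-1
  v-ϖ^ (fin (suc n)) = ≡.trans (v-* ϖ (ϖ^ (fin n))) (≡.cong₂ _+∞_ v-ϖ (v-ϖ^ (fin n)))

  inOˣ : Carrier → Set
  inOˣ x = v x ≡ fin (+ 0)

  inOˣ⇒inO : ∀ {x} → inOˣ x → inO x
  inOˣ⇒inO x∈Oˣ = ≡.subst (fin (+ 0) ≤∞_) (≡.sym x∈Oˣ) (fin≤fin ℤ.≤-refl)

  v-scale : ∀ {a x k} → inOˣ k → v (a * x * k) ≡ v a +∞ v x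
  v-scale {a} {x} {k} k∈Oˣ = begin
    v (a * x * k)              ≡⟨ v-* (a * x) k ⟩
    v (a * x) +∞ v k           ≡⟨ ≡.cong₂ _+∞_ (v-* a x) k∈Oˣ ⟩
    (v a +∞ v x) +∞ fin (+ 0)  ≡⟨ +∞-identityʳ _ ⟩
    v a +∞ v x                 ∎
    where open ≡.≡-Reasoning

  diag : Carrier → Carrier → M2
  diag a b = mat a 0# 0# b

  unipotent : Carrier → M2
  unipotent x = mat 1# x 0# 1#

  ≈M-refl : ∀ {m} → m ≈M m
  ≈M-refl = refl , refl , refl , refl

  ≈M-sym : ∀ {m n} → m ≈M n → n ≈M m
  ≈M-sym (p₁₁ , p₁₂ , p₂₁ , p₂₂) = sym p₁₁ , sym p₁₂ , sym p₂₁ , sym p₂₂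

  ≈M-trans : ∀ {l m n} → l ≈M m → m ≈M n → l ≈M n
  ≈M-trans (p₁₁ , p₁₂ , p₂₁ , p₂₂) (q₁₁ , q₁₂ , q₂₁ , q₂₂) =
    trans p₁₁ q₁₁ , trans p₁₂ q₁₂ , trans p₂₁ q₂₁ , trans p₂₂ q₂₂

  ·-cong : ∀ {m m′ n n′} → m ≈M m′ → n ≈M n′ → (m · n) ≈M (m′ · n′)
  ·-cong (p₁₁ , p₁₂ , p₂₁ , p₂₂) (q₁₁ , q₁₂ , q₂₁ , q₂₂) =
    +-cong (*-cong p₁₁ q₁₁) (*-cong p₁₂ q₂₁) , +-cong (*-cong p₁₁ q₁₂) (*-cong p₁₂ q₂₂) ,
    +-cong (*-cong p₂₁ q₁₁) (*-cong p₂₂ q₂₁) , +-cong (*-cong p₂₁ q₁₂) (*-cong p₂₂ q₂₂)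

  det-cong : ∀ {m m′} → m ≈M m′ → det m ≈ det m′
  det-cong (p₁₁ , p₁₂ , p₂₁ , p₂₂) = +-cong (*-cong p₁₁ p₂₂) (-‿cong (*-cong p₁₂ p₂₁))

  det-diag : ∀ a b → det (diag a b) ≈ a * b
  det-diag = solve 2 (λ a b → a :* b :- con (+ 0) :* con (+ 0) := a :* b) refl

  x+0*y≈x : ∀ x y → x + 0# * y ≈ x
  x+0*y≈x x y = trans (+-congˡ (zeroˡ y)) (+-identityʳ x)

  0*x+y≈y : ∀ x y → 0# * x + y ≈ y
  0*x+y≈y x y = trans (+-congʳ (zeroˡ x)) (+-identityˡ y)

  x+y*0≈x : ∀ x y → x + y * 0# ≈ x
  x+y*0≈x x y = trans (+-congˡ (zeroʳ y)) (+-identityʳ x)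

  x*0+y≈y : ∀ x y → x * 0# + y ≈ y
  x*0+y≈y x y = trans (+-congʳ (zeroʳ x)) (+-identityˡ y)

  diag·≈M : ∀ a b m → (diag a b · m) ≈M mat (a * e11 m) (a * e12 m) (b * e21 m) (b * e22 m)
  diag·≈M a b m = x+0*y≈x _ _ , x+0*y≈x _ _ , 0*x+y≈y _ _ , 0*x+y≈y _ _

  ·diag≈M : ∀ a b m → (m · diag a b) ≈M mat (e11 m * a) (e12 m * b) (e21 m * a) (e22 m * b)
  ·diag≈M a b m = x+y*0≈x _ _ , x*0+y≈y _ _ , x+y*0≈x _ _ , x*0+y≈y _ _

  unipotent·≈M : ∀ x m → (unipotent x · m) ≈M mat (e11 m + x * e21 m) (e12 m + x * e22 m) (e21 m) (e22 m)
  unipotent·≈M x m = +-congʳ (*-identityˡ _) , +-congʳ (*-identityˡ _) ,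
                     trans (0*x+y≈y _ _) (*-identityˡ _) , trans (0*x+y≈y _ _) (*-identityˡ _)

  translate : (x a₁ a₂ k₁ k₂ : Carrier) → M2 → M2
  translate x a₁ a₂ k₁ k₂ g =
    mat (a₁ * e11 g * k₁ + x * (a₂ * e21 g * k₁)) (a₁ * e12 g * k₂ + x * (a₂ * e22 g * k₂))
        (a₂ * e21 g * k₁) (a₂ * e22 g * k₂)

  unipotent·diag·diag : ∀ x a₁ a₂ k₁ k₂ g →
    (unipotent x · (diag a₁ a₂ · g · diag k₁ k₂)) ≈M translate x a₁ a₂ k₁ k₂ g
  unipotent·diag·diag x a₁ a₂ k₁ k₂ g =
    ≈M-trans (·-cong ≈M-refl (≈M-trans (·-cong (diag·≈M a₁ a₂ g) ≈M-refl) (·diag≈M k₁ k₂ _)))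
             (unipotent·≈M x _)

  inA⇒≈diag : ∀ {a} → inA a → a ≈M diag (e11 a) (e22 a)
  inA⇒≈diag (_ , a₁₂≈0 , a₂₁≈0) = refl , a₁₂≈0 , a₂₁≈0 , refl

  inN⇒≈unipotent : ∀ {n} → inN n → n ≈M unipotent (e12 n)
  inN⇒≈unipotent (n₁₁≈1 , n₂₁≈0 , n₂₂≈1) = n₁₁≈1 , refl , n₂₁≈0 , n₂₂≈1

  diag∈A : ∀ {a₁ a₂} → a₁ * a₂ ≉ 0# → inA (diag a₁ a₂)
  diag∈A {a₁} {a₂} a₁a₂≉0 = (λ det≈0 → a₁a₂≉0 (trans (sym (det-diag a₁ a₂)) det≈0)) , refl , refl

  0∈O : inO 0#
  0∈O = ≡.subst (fin (+ 0) ≤∞_) (≡.sym v-0) ≤∞∞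

  diag∈KA : ∀ {k₁ k₂} → inOˣ k₁ → inOˣ k₂ → inKA (diag k₁ k₂)
  diag∈KA {k₁} {k₂} k₁∈Oˣ k₂∈Oˣ =
    (v-fin⇒≉0 v-det , refl , refl) , inOˣ⇒inO k₁∈Oˣ , 0∈O , 0∈O , inOˣ⇒inO k₂∈Oˣ , v-det
    where
    v-det : v (det (diag k₁ k₂)) ≡ fin (+ 0)
    v-det = ≡.trans (v-cong (det-diag k₁ k₂)) (≡.trans (v-* k₁ k₂) (≡.cong₂ _+∞_ k₁∈Oˣ k₂∈Oˣ))

  inA⇒e22≉0 : ∀ {a} → inA a → e22 a ≉ 0#
  inA⇒e22≉0 {a} a∈A@(det≉0 , _) a₂₂≈0 = det≉0 (begin
    det a           ≈⟨ det-cong (inA⇒≈diag a∈A) ⟩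
    det (diag _ _)  ≈⟨ det-diag _ _ ⟩
    e11 a * e22 a   ≈⟨ *-congˡ a₂₂≈0 ⟩
    e11 a * 0#      ≈⟨ zeroʳ _ ⟩
    0#              ∎)
    where open ≈-Reasoning

  inKA⇒diagonal∈Oˣ : ∀ {k} → inKA k → inOˣ (e11 k) × inOˣ (e22 k)
  inKA⇒diagonal∈Oˣ {k} (k∈A , k₁₁∈O , _ , _ , k₂₂∈O , v-det) =
    nonNegative-+∞≡0 k₁₁∈O k₂₂∈O (≡.trans (≡.sym (v-* _ _)) (≡.trans (≡.sym (v-cong det≈)) v-det))
    where
    det≈ : det k ≈ e11 k * e22 k
    det≈ = trans (det-cong (inA⇒≈diag k∈A)) (det-diag _ _)

  sameOrbit-intro : ∀ {g h} x a₁ a₂ k₁ k₂ → a₁ * a₂ ≉ 0# → inOˣ k₁ → inOˣ k₂ →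
                    h ≈M translate x a₁ a₂ k₁ k₂ g → SameOrbit g h
  sameOrbit-intro {g} x a₁ a₂ k₁ k₂ a₁a₂≉0 k₁∈Oˣ k₂∈Oˣ h≈ =
    diag a₁ a₂ , diag k₁ k₂ , unipotent x ,
    diag∈A a₁a₂≉0 , diag∈KA k₁∈Oˣ k₂∈Oˣ , (refl , refl , refl) ,
    ≈M-trans h≈ (≈M-sym (unipotent·diag·diag x a₁ a₂ k₁ k₂ g))

  BottomRowScaled : M2 → M2 → Set (c ⊔ ℓ)
  BottomRowScaled g h = Σ[ a ∈ Carrier ] Σ[ k₁ ∈ Carrier ] Σ[ k₂ ∈ Carrier ]
    a ≉ 0# × inOˣ k₁ × inOˣ k₂ × e21 h ≈ a * e21 g * k₁ × e22 h ≈ a * e22 g * k₂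

  sameOrbit⇒bottomRowScaled : ∀ {g h} → SameOrbit g h → BottomRowScaled g h
  sameOrbit⇒bottomRowScaled {g} {h} (a , k , n , a∈A , k∈KA , n∈N , h≈nagk) =
    let k₁₁∈Oˣ , k₂₂∈Oˣ = inKA⇒diagonal∈Oˣ k∈KA
        _ , _ , eq₂₁ , eq₂₂ = h≈
    in  e22 a , e11 k , e22 k , inA⇒e22≉0 a∈A , k₁₁∈Oˣ , k₂₂∈Oˣ , eq₂₁ , eq₂₂
    where
    h≈ : h ≈M translate (e12 n) (e11 a) (e22 a) (e11 k) (e22 k) g
    nagk≈ : (n · (a · g · k)) ≈M (unipotent (e12 n) · (diag (e11 a) (e22 a) · g · diag (e11 k) (e22 k)))
    nagk≈ = ·-cong (inN⇒≈unipotent n∈N) (·-cong (·-cong (inA⇒≈diag a∈A) ≈M-refl) (inA⇒≈diag (proj₁ k∈KA)))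
    h≈ = ≈M-trans h≈nagk (≈M-trans nagk≈ (unipotent·diag·diag _ _ _ _ _ g))

  -- By Cramer's rule, a₁ and x write the top row of h as a₁ (p k₁, q k₂) + x (a r k₁, a s k₂);
  -- D is the determinant of this linear system.
  bottomRowScaled⇒sameOrbit : ∀ {g h} → inG g → inG h → BottomRowScaled g h → SameOrbit g h
  bottomRowScaled⇒sameOrbit {mat p q r s} {mat h₁₁ h₁₂ h₂₁ h₂₂} g∈G h∈G
                            (a , k₁ , k₂ , a≉0 , k₁∈Oˣ , k₂∈Oˣ , eq₂₁ , eq₂₂) =
    sameOrbit-intro x a₁ a k₁ k₂ (*-≉0 (*-≉0 h∈G (inv-≉0 D≉0)) a≉0) k₁∈Oˣ k₂∈Oˣ
                    (eq₁₁ , eq₁₂ , eq₂₁ , eq₂₂)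
    where
    open ≈-Reasoning
    D : Carrier
    D = a * k₁ * k₂ * (p * s - q * r)
    D≉0 : D ≉ 0#
    D≉0 = *-≉0 (*-≉0 (*-≉0 a≉0 (v-fin⇒≉0 k₁∈Oˣ)) (v-fin⇒≉0 k₂∈Oˣ)) g∈G
    D⁻¹ a₁ x : Carrier
    D⁻¹ = inv D D≉0
    a₁ = (h₁₁ * h₂₂ - h₁₂ * h₂₁) * D⁻¹
    x  = (p * k₁ * h₁₂ - q * k₂ * h₁₁) * D⁻¹
    det-h : h₁₁ * h₂₂ - h₁₂ * h₂₁ ≈ h₁₁ * (a * s * k₂) - h₁₂ * (a * r * k₁)
    det-h = +-cong (*-congˡ eq₂₂) (-‿cong (*-congˡ eq₂₁))
    ≈*DD⁻¹ : ∀ y → y ≈ y * (D * D⁻¹)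
    ≈*DD⁻¹ y = sym (trans (*-congˡ (inv-r D D≉0)) (*-identityʳ y))
    eq₁₁ : h₁₁ ≈ a₁ * p * k₁ + x * (a * r * k₁)
    eq₁₁ = begin
      h₁₁
        ≈⟨ ≈*DD⁻¹ h₁₁ ⟩
      h₁₁ * (D * D⁻¹)
        ≈⟨ solve 10 (λ h₁₁ h₁₂ p q r s a k₁ k₂ D⁻¹ →
             h₁₁ :* (a :* k₁ :* k₂ :* (p :* s :- q :* r) :* D⁻¹)
             := (h₁₁ :* (a :* s :* k₂) :- h₁₂ :* (a :* r :* k₁)) :* D⁻¹ :* p :* k₁
                :+ (p :* k₁ :* h₁₂ :- q :* k₂ :* h₁₁) :* D⁻¹ :* (a :* r :* k₁))
             refl h₁₁ h₁₂ p q r s a k₁ k₂ D⁻¹ ⟩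
      (h₁₁ * (a * s * k₂) - h₁₂ * (a * r * k₁)) * D⁻¹ * p * k₁ + x * (a * r * k₁)
        ≈⟨ +-congʳ (*-congʳ (*-congʳ (*-congʳ det-h))) ⟨
      a₁ * p * k₁ + x * (a * r * k₁)
        ∎
    eq₁₂ : h₁₂ ≈ a₁ * q * k₂ + x * (a * s * k₂)
    eq₁₂ = begin
      h₁₂
        ≈⟨ ≈*DD⁻¹ h₁₂ ⟩
      h₁₂ * (D * D⁻¹)
        ≈⟨ solve 10 (λ h₁₁ h₁₂ p q r s a k₁ k₂ D⁻¹ →
             h₁₂ :* (a :* k₁ :* k₂ :* (p :* s :- q :* r) :* D⁻¹)
             := (h₁₁ :* (a :* s :* k₂) :- h₁₂ :* (a :* r :* k₁)) :* D⁻¹ :* q :* k₂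
                :+ (p :* k₁ :* h₁₂ :- q :* k₂ :* h₁₁) :* D⁻¹ :* (a :* s :* k₂))
             refl h₁₁ h₁₂ p q r s a k₁ k₂ D⁻¹ ⟩
      (h₁₁ * (a * s * k₂) - h₁₂ * (a * r * k₁)) * D⁻¹ * q * k₂ + x * (a * s * k₂)
        ≈⟨ +-congʳ (*-congʳ (*-congʳ (*-congʳ det-h))) ⟨
      a₁ * q * k₂ + x * (a * s * k₂)
        ∎

  κ∈G : ∀ r → inG (κ r)
  κ∈G (lower γ) det≈0 = nontrivial (begin
    1#                 ≈⟨ solve 1 (λ c → con (+ 1) := con (+ 1) :* con (+ 1) :- con (+ 0) :* c) refl (ϖ^ γ) ⟩
    det (κ (lower γ))  ≈⟨ det≈0 ⟩
    0#                 ∎)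
    where open ≈-Reasoning
  κ∈G (swap γ p) det≈0 = nontrivial (begin
    1#                    ≈⟨ solve 1 (λ c → con (+ 1) := :- (con (+ 0) :* c :- con (+ 1) :* con (+ 1))) refl (ϖ^ γ) ⟩
    - det (κ (swap γ p))  ≈⟨ -‿cong det≈0 ⟩
    - 0#                  ≈⟨ -0#≈0# ⟩
    0#                    ∎)
    where open ≈-Reasoning

  det≈0-of-bottomRow≈0 : ∀ {g} → e21 g ≈ 0# → e22 g ≈ 0# → det g ≈ 0#
  det≈0-of-bottomRow≈0 {mat p q r s} r≈0 s≈0 = begin
    p * s - q * r    ≈⟨ +-cong (*-congˡ s≈0) (-‿cong (*-congˡ r≈0)) ⟩
    p * 0# - q * 0#  ≈⟨ solve 2 (λ p q → p :* con (+ 0) :- q :* con (+ 0) := con (+ 0)) refl p q ⟩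
    0#               ∎
    where open ≈-Reasoning

  ϖ^-up-to-unit : ∀ {x y} (y≉0 : y ≉ 0#) γ → v x ≡ toℤ∞ γ +∞ v y →
                  Σ[ k ∈ Carrier ] inOˣ k × ϖ^ γ ≈ inv y y≉0 * x * k
  ϖ^-up-to-unit {x} {y} y≉0 ∞ vx = 1# , v-1 , (begin
    0#                  ≈⟨ zeroʳ _ ⟨
    inv y y≉0 * 0#      ≈⟨ *-congˡ (v-∞⇒0 x vx) ⟨
    inv y y≉0 * x       ≈⟨ *-identityʳ _ ⟨
    inv y y≉0 * x * 1#  ∎)
    where open ≈-Reasoning
  ϖ^-up-to-unit {x} {y} y≉0 (fin n) vx = k , k∈Oˣ , ϖ^n≈
    where
    t : ℤ
    t = proj₁ (≉0⇒v-fin y≉0)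
    vx≡fin : v x ≡ fin (+ n ℤ.+ t)
    vx≡fin = ≡.trans vx (≡.cong (fin (+ n) +∞_) (proj₂ (≉0⇒v-fin y≉0)))
    x≉0 : x ≉ 0#
    x≉0 = v-fin⇒≉0 vx≡fin
    P k : Carrier
    P = ϖ^ (fin n)
    k = P * y * inv x x≉0
    kx≈Py : k * x ≈ P * y
    kx≈Py = begin
      P * y * inv x x≉0 * x    ≈⟨ *-assoc _ _ _ ⟩
      P * y * (inv x x≉0 * x)  ≈⟨ *-congˡ (inv-l x≉0) ⟩
      P * y * 1#               ≈⟨ *-identityʳ _ ⟩
      P * y                    ∎
      where open ≈-Reasoning
    k∈Oˣ : inOˣ k
    k∈Oˣ = +∞-identityˡ-unique (v k) (+ n ℤ.+ t) (begin
      v k +∞ fin (+ n ℤ.+ t)  ≡⟨ ≡.cong (v k +∞_) vx≡fin ⟨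
      v k +∞ v x              ≡⟨ v-* k x ⟨
      v (k * x)               ≡⟨ v-cong kx≈Py ⟩
      v (P * y)               ≡⟨ v-* P y ⟩
      v P +∞ v y              ≡⟨ ≡.cong (_+∞ v y) (v-ϖ^ (fin n)) ⟩
      fin (+ n) +∞ v y        ≡⟨ vx ⟨
      v x                     ≡⟨ vx≡fin ⟩
      fin (+ n ℤ.+ t)         ∎)
      where open ≡.≡-Reasoning
    ϖ^n≈ : P ≈ inv y y≉0 * x * k
    ϖ^n≈ = begin
      P
        ≈⟨ sym (trans (*-cong (*-congˡ (inv-l y≉0)) (inv-r x x≉0)) (trans (*-identityʳ _) (*-identityʳ P))) ⟩
      P * (inv y y≉0 * y) * (x * inv x x≉0)
        ≈⟨ solve 5 (λ P y y⁻¹ x x⁻¹ → P :* (y⁻¹ :* y) :* (x :* x⁻¹) := y⁻¹ :* x :* (P :* y :* x⁻¹))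
                   refl P y (inv y y≉0) x (inv x x≉0) ⟩
      inv y y≉0 * x * k
        ∎
      where open ≈-Reasoning

  κ-lower-reached : ∀ {g} γ → inG g → (s≉0 : e22 g ≉ 0#) → v (e21 g) ≡ toℤ∞ γ +∞ v (e22 g) →
                    SameOrbit g (κ (lower γ))
  κ-lower-reached γ g∈G s≉0 vr =
    let k , k∈Oˣ , ϖ^γ≈ = ϖ^-up-to-unit s≉0 γ vr
    in  bottomRowScaled⇒sameOrbit g∈G (κ∈G (lower γ))
          (inv _ s≉0 , k , 1# , inv-≉0 s≉0 , k∈Oˣ , v-1 , ϖ^γ≈ , sym (trans (*-identityʳ _) (inv-l s≉0)))

  κ-swap-reached : ∀ {g} γ (1≤γ : 1≤∞ γ) → inG g → (r≉0 : e21 g ≉ 0#) →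
                   v (e22 g) ≡ toℤ∞ γ +∞ v (e21 g) → SameOrbit g (κ (swap γ 1≤γ))
  κ-swap-reached γ 1≤γ g∈G r≉0 vs =
    let k , k∈Oˣ , ϖ^γ≈ = ϖ^-up-to-unit r≉0 γ vs
    in  bottomRowScaled⇒sameOrbit g∈G (κ∈G (swap γ 1≤γ))
          (inv _ r≉0 , 1# , k , inv-≉0 r≉0 , v-1 , k∈Oˣ , sym (trans (*-identityʳ _) (inv-l r≉0)) , ϖ^γ≈)

  κ-reached : ∀ g → inG g → Σ Rep (λ r → SameOrbit g (κ r))
  κ-reached g g∈G with v (e22 g) in vs
  ... | ∞ = swap ∞ 1≤∞∞ , κ-swap-reached ∞ 1≤∞∞ g∈G r≉0 vs
    where
    r≉0 : e21 g ≉ 0#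
    r≉0 r≈0 = g∈G (det≈0-of-bottomRow≈0 r≈0 (v-∞⇒0 _ vs))
  ... | fin j with compare-with-fin (v (e21 g)) j
  ...   | inj₁ (γ , vr) =
            lower γ , κ-lower-reached γ g∈G (v-fin⇒≉0 vs) (≡.trans vr (≡.cong (toℤ∞ γ +∞_) (≡.sym vs)))
  ...   | inj₂ (i , m , vr , j≡) =
            swap (fin (suc m)) 1≤fin ,
            κ-swap-reached _ 1≤fin g∈G (v-fin⇒≉0 vr)
              (≡.trans vs (≡.trans j≡ (≡.cong (fin (+ suc m) +∞_) (≡.sym vr))))

  1≤∞⇒toℤ∞≢0 : ∀ {γ} → 1≤∞ γ → toℤ∞ γ ≢ fin (+ 0)
  1≤∞⇒toℤ∞≢0 1≤fin ()
  1≤∞⇒toℤ∞≢0 1≤∞∞  ()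

  1≤∞-irrelevant : ∀ {γ} (p q : 1≤∞ γ) → p ≡ q
  1≤∞-irrelevant 1≤fin 1≤fin = ≡.refl
  1≤∞-irrelevant 1≤∞∞  1≤∞∞  = ≡.refl

  min-v-κ-bottomRow : ∀ r → min∞ (v (e21 (κ r))) (v (e22 (κ r))) ≡ fin (+ 0)
  min-v-κ-bottomRow (lower γ)  = ≡.trans (≡.cong₂ min∞ (v-ϖ^ γ) v-1) (min∞-toℤ∞-0 γ)
  min-v-κ-bottomRow (swap γ _) = ≡.trans (≡.cong₂ min∞ v-1 (v-ϖ^ γ)) (min∞-0-toℤ∞ γ)

  v-κ-bottomRow-injective : ∀ r s → v (e21 (κ s)) ≡ v (e21 (κ r)) → v (e22 (κ s)) ≡ v (e22 (κ r)) → r ≡ s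
  v-κ-bottomRow-injective (lower γ) (lower δ) v₂₁≡ _ =
    ≡.cong lower (toℤ∞-injective (≡.trans (≡.sym (v-ϖ^ γ)) (≡.trans (≡.sym v₂₁≡) (v-ϖ^ δ))))
  v-κ-bottomRow-injective (swap γ p) (swap δ q) _ v₂₂≡
    with toℤ∞-injective (≡.trans (≡.sym (v-ϖ^ γ)) (≡.trans (≡.sym v₂₂≡) (v-ϖ^ δ)))
  ... | ≡.refl = ≡.cong (swap γ) (1≤∞-irrelevant p q)
  v-κ-bottomRow-injective (lower γ) (swap δ q) _ v₂₂≡ =
    ⊥-elim (1≤∞⇒toℤ∞≢0 q (≡.trans (≡.sym (v-ϖ^ δ)) (≡.trans v₂₂≡ v-1)))
  v-κ-bottomRow-injective (swap γ p) (lower δ) _ v₂₂≡ =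
    ⊥-elim (1≤∞⇒toℤ∞≢0 p (≡.trans (≡.sym (v-ϖ^ γ)) (≡.trans (≡.sym v₂₂≡) v-1)))

  κ-orbits-disjoint : ∀ r s → SameOrbit (κ r) (κ s) → r ≡ s
  κ-orbits-disjoint r s orbit =
    let a , k₁ , k₂ , a≉0 , k₁∈Oˣ , k₂∈Oˣ , eq₂₁ , eq₂₂ = sameOrbit⇒bottomRowScaled orbit
        t , va = ≉0⇒v-fin a≉0
        v₂₁≡ , v₂₂≡ = min≡0-shift⇒≡ (min-v-κ-bottomRow r) (min-v-κ-bottomRow s)
                        (≡.trans (v-cong eq₂₁) (≡.trans (v-scale k₁∈Oˣ) (≡.cong (_+∞ v (e21 (κ r))) va)))
                        (≡.trans (v-cong eq₂₂) (≡.trans (v-scale k₂∈Oˣ) (≡.cong (_+∞ v (e22 (κ r))) va)))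
    in  v-κ-bottomRow-injective r s v₂₁≡ v₂₂≡

proposition5p1 : {c ℓ : Level} (F : NALocalField c ℓ) → let open GL2 F in
    ((g : M2) → inG g → Σ Rep (λ r → SameOrbit g (κ r)))
    × ((r s : Rep) → SameOrbit (κ r) (κ s) → r ≡ s)
proposition5p1 F = κ-reached , κ-orbits-disjoint
  where open Orbits F
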